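{- If $G$ is a connected unit interval graph with minimum degree $\delta(G) \geq 2$, then $rc(G) = diam(G)$.
   Context: A unit interval graph is an intersection graph of unit-length intervals on the real line. An edge-coloured graph is rainbow connected if every pair of vertices is joined by a path no two of whose edges have the same colour; $rc(G)$ is the minimum number of colours in an edge colouring making the connected graph $G$ rainbow connected. $diam(G)$ is the maximum distance between two vertices.
   Formalization: The unit-length intervals representing G have rational left endpoints instead of arbitrary real ones. -}

module Defs where

open import Data.Nat using (ℕ; suc; _≤_; _<_)
open import Data.Fin using (Fin; inject₁; zero; fromℕ)
  renaming (suc to fsuc)
open import Data.Rational using (ℚ; _+_; 1ℚ)
  renaming (_≤_ to _≤ℚ_)
open import Data.Product using (Σ; _×_; ∃; ∃-syntax)
open import Relation.Binary.PropositionalEquality using (_≡_; _≢_)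
open import Relation.Nullary using (¬_)

record Graph (n : ℕ) : Set₁ where
  field
    Adj   : Fin n → Fin n → Set
    irrefl : ∀ u → ¬ Adj u u
    sym   : ∀ u v → Adj u v → Adj v u
open Graph public

-- The intersection graph of the closed unit intervals [x u , x u + 1], u ∈ Fin n:
-- [a, a+1] and [b, b+1] intersect iff a ≤ b + 1 and b ≤ a + 1.
-- (Finite unit interval graphs are exactly those representable with rational endpoints.)
unitIntervalGraph : ∀ {n} → (Fin n → ℚ) → Graph n
unitIntervalGraph {n} x = record
  { Adj = λ u v → (u ≢ v) × (x u ≤ℚ x v + 1ℚ) × (x v ≤ℚ x u + 1ℚ)
  ; irrefl = λ u p → proj₁ p refl
  ; sym = λ u v p → (λ e → proj₁ p (≡-sym e)) , proj₂ (proj₂ p) , proj₁ (proj₂ p) }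
  where open import Data.Product using (_,_; proj₁; proj₂)
        open import Relation.Binary.PropositionalEquality using (refl) renaming (sym to ≡-sym)

IsUnitIntervalGraph : ∀ {n} → Graph n → Set
IsUnitIntervalGraph {n} G =
  Σ (Fin n → ℚ) λ x → ∀ u v → (Adj G u v → Adj (unitIntervalGraph x) u v)
                             × (Adj (unitIntervalGraph x) u v → Adj G u v)

record Path {n} (G : Graph n) (u v : Fin n) (m : ℕ) : Set where
  field
    vtx      : Fin (suc m) → Fin n
    start    : vtx zero ≡ u
    end      : vtx (fromℕ m) ≡ v
    adjacent : ∀ (i : Fin m) → Adj G (vtx (inject₁ i)) (vtx (fsuc i))
    distinct : ∀ i j → vtx i ≡ vtx j → i ≡ j
open Path public

Connected : ∀ {n} → Graph n → Set
Connected {n} G = ∀ (u v : Fin n) → ∃[ m ] Path G u v m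

MinDegreeAtLeast2 : ∀ {n} → Graph n → Set
MinDegreeAtLeast2 {n} G = ∀ (v : Fin n) → ∃[ a ] ∃[ b ] (a ≢ b × Adj G v a × Adj G v b)

IsDist : ∀ {n} → Graph n → Fin n → Fin n → ℕ → Set
IsDist G u v d = Path G u v d × (∀ m → Path G u v m → d ≤ m)

IsDiam : ∀ {n} → Graph n → ℕ → Set
IsDiam {n} G d = (∃[ u ] ∃[ v ] IsDist G u v d)
               × (∀ u v e → IsDist G u v e → e ≤ d)

record EdgeColouring {n} (G : Graph n) (k : ℕ) : Set where
  field
    col    : Fin n → Fin n → Fin k
    col-sym : ∀ u v → Adj G u v → col u v ≡ col v u
open EdgeColouring public

Rainbow : ∀ {n} {G : Graph n} {k} → EdgeColouring G k → ∀ {u v m} → Path G u v m → Set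
Rainbow c {m = m} p =
  ∀ (i j : Fin m) → col c (vtx p (inject₁ i)) (vtx p (fsuc i))
                    ≡ col c (vtx p (inject₁ j)) (vtx p (fsuc j)) → i ≡ j

RainbowConnected : ∀ {n} {G : Graph n} {k} → EdgeColouring G k → Set
RainbowConnected {n} {G} c = ∀ (u v : Fin n) → ∃[ m ] Σ (Path G u v m) (Rainbow c)

IsRc : ∀ {n} → Graph n → ℕ → Set
IsRc G k = Σ (EdgeColouring G k) RainbowConnected
         × (∀ j → j < k → ¬ Σ (EdgeColouring G j) RainbowConnected)

{-# OPTIONS --safe #-}
-- Start at the leftmost interval and repeatedly jump to the rightmost interval
-- meeting the current one; call these greedy vertices g₀, g₁, …, and put a vertex u
-- in layer ℓ when ℓ is least with x u ≤ x gℓ. A path of length m from g₀ never gets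
-- right of gₘ, so the layer D of the rightmost vertex is its distance from g₀ and
-- D ≤ diam G. Layer ℓ + 1 lies in the band [x gℓ , x gℓ₊₁] of width at most 1, so every
-- band is a clique. Colouring an edge by the larger layer of its ends minus one, a
-- vertex reaches any vertex of a higher layer through consecutive greedy vertices,
-- one layer per step, hence along consecutive colours; vertices of equal layer are
-- adjacent. So max (D , 1) ≤ diam G colours suffice, and fewer cannot join two vertices
-- at distance diam G. Minimum degree 2 is only used to have an edge, so diam G ≥ 1.
module Submission where

open import Defs hiding (sym)
open import Data.Nat using (ℕ; zero; suc; pred; _+_; _∸_; _⊔_; _≤_; _<_; z≤n; s≤s; _<?_)
open import Data.Nat.Properties
  using ( ≤-refl; ≤-trans; ≤-reflexive; <-irrefl; ≤-<-trans; <⇒≤; <⇒≱; ≮⇒≥; ≤-pred; <-cmp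
        ; m<1+n⇒m<n∨m≡n; m≤n⇒m<n∨m≡n; n≤1+n; n≤0⇒n≡0; 1+n≢n; suc-injective; pred[n]≤n
        ; +-comm; +-identityʳ; +-suc; +-cancelʳ-≡; +-monoˡ-≤; m<n+m; m∸n+n≡m; m∸n≤m; n∸n≡0
        ; ∸-cancelˡ-≡; ∸-monoʳ-<; m<n⇒0<n∸m; ⊔-comm; ⊔-lub; m≤n⇒m⊔n≡n )
open import Data.Fin using (Fin; toℕ; fromℕ; fromℕ<; inject₁; _≟_)
  renaming (zero to fzero; suc to fsuc)
open import Data.Fin.Properties
  using (toℕ-fromℕ; toℕ-fromℕ<; toℕ-inject₁; toℕ<n; toℕ-injective; injective⇒≤)
open import Data.Rational using (ℚ; 1ℚ) renaming (_≤_ to _≤ℚ_; _<_ to _<ℚ_; _+_ to _+ℚ_)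
import Data.Rational.Properties as ℚ
open import Data.List using (allFin; filter)
open import Data.List.Relation.Unary.All using (lookup)
open import Data.List.Relation.Unary.All.Properties using (all-filter)
open import Data.List.Membership.Propositional.Properties using (∈-allFin; ∈-filter⁺)
import Data.List.Extrema
open import Data.Product using (Σ; _×_; _,_; proj₁; proj₂; ∃)
open import Data.Sum using (inj₁; inj₂)
open import Relation.Nullary using (¬_; yes; no; contradiction)
open import Relation.Nullary.Decidable using (_×-dec_)
open import Relation.Unary using (Decidable)
open import Relation.Binary.PropositionalEquality
  using (_≡_; _≢_; refl; sym; trans; cong; cong₂; subst; subst₂; module ≡-Reasoning)
open import Relation.Binary using (tri<; tri≈; tri>; DecTotalOrder)

Least : (ℕ → Set) → ℕ → Set
Least P k = P k × (∀ {j} → j < k → ¬ P j)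

module _ {P : ℕ → Set} where

  least-exists : Decidable P → ∀ m → P m → ∃ (Least P)
  least-exists P? m pm = search m 0 (λ ()) (subst P (sym (+-identityʳ m)) pm)
    where
    search : ∀ fuel k → (∀ {j} → j < k → ¬ P j) → P (fuel + k) → ∃ (Least P)
    search fuel k below p with P? k
    ... | yes pk = k , pk , below
    search zero       k below p | no ¬pk = contradiction p ¬pk
    search (suc fuel) k below p | no ¬pk =
      search fuel (suc k) below′ (subst P (sym (+-suc fuel k)) p)
      where
      below′ : ∀ {j} → j < suc k → ¬ P j
      below′ j<1+k with m<1+n⇒m<n∨m≡n j<1+k
      ... | inj₁ j<k  = below j<k
      ... | inj₂ refl = ¬pk

  Least⇒≤ : ∀ {k j} → Least P k → P j → k ≤ j
  Least⇒≤ (_ , below) pj = ≮⇒≥ (λ j<k → below j<k pj)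

  Least-unique : ∀ {k k′} → Least P k → Least P k′ → k ≡ k′
  Least-unique {k} {k′} l l′ with <-cmp k k′
  ... | tri< k<k′ _ _ = contradiction (proj₁ l) (proj₂ l′ k<k′)
  ... | tri≈ _ k≡k′ _ = k≡k′
  ... | tri> _ _ k′<k = contradiction (proj₁ l′) (proj₂ l k′<k)

m∸n≡1+m∸1+n : ∀ {m n} → n < m → m ∸ n ≡ suc (m ∸ suc n)
m∸n≡1+m∸1+n {suc m} {zero}  _         = refl
m∸n≡1+m∸1+n {suc m} {suc n} (s≤s n<m) = m∸n≡1+m∸1+n n<m

module Walks {n : ℕ} (G : Graph n) where

  record Walk (u v : Fin n) (m : ℕ) : Set where
    field
      node     : ℕ → Fin n
      node-0   : node 0 ≡ u
      node-m   : node m ≡ v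
      node-adj : ∀ {i} → i < m → Adj G (node i) (node (suc i))
      node-inj : ∀ {i j} → i ≤ m → j ≤ m → node i ≡ node j → i ≡ j
  open Walk public

  Walk⇒Path : ∀ {u v m} → Walk u v m → Path G u v m
  Walk⇒Path {m = m} w = record
    { vtx      = λ i → node w (toℕ i)
    ; start    = node-0 w
    ; end      = trans (cong (node w) (toℕ-fromℕ m)) (node-m w)
    ; adjacent = λ i → subst (λ k → Adj G (node w k) (node w (suc (toℕ i))))
                             (sym (toℕ-inject₁ i)) (node-adj w (toℕ<n i))
    ; distinct = λ i j eq → toℕ-injective
                   (node-inj w (≤-pred (toℕ<n i)) (≤-pred (toℕ<n j)) eq)
    }

  stay : ∀ u → Walk u u 0
  stay u = record
    { node = λ _ → u ; node-0 = refl ; node-m = refl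
    ; node-adj = λ () ; node-inj = λ i≤0 j≤0 _ → trans (n≤0⇒n≡0 i≤0) (sym (n≤0⇒n≡0 j≤0)) }

  edgeWalk : ∀ {u v} → Adj G u v → Walk u v 1
  edgeWalk {u} {v} u~v = record
    { node     = ends
    ; node-0   = refl
    ; node-m   = refl
    ; node-adj = λ { {zero} _ → u~v ; {suc _} (s≤s ()) }
    ; node-inj = inj
    }
    where
    ends : ℕ → Fin n
    ends zero    = u
    ends (suc _) = v
    u≢v : u ≢ v
    u≢v refl = irrefl G u u~v
    inj : ∀ {i j} → i ≤ 1 → j ≤ 1 → ends i ≡ ends j → i ≡ j
    inj {zero}     {zero}     _ _ _  = refl
    inj {suc zero} {suc zero} _ _ _  = refl
    inj {zero}     {suc zero} _ _ eq = contradiction eq u≢v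
    inj {suc zero} {zero}     _ _ eq = contradiction (sym eq) u≢v
    inj {suc (suc _)} (s≤s ()) _
    inj {_} {suc (suc _)} _ (s≤s ())

  reverse : ∀ {u v m} → Walk u v m → Walk v u m
  reverse {u} {v} {m} w = record
    { node     = λ i → node w (m ∸ i)
    ; node-0   = node-m w
    ; node-m   = subst (λ k → node w k ≡ u) (sym (n∸n≡0 m)) (node-0 w)
    ; node-adj = λ {i} i<m → subst (λ k → Adj G (node w k) (node w (m ∸ suc i)))
                                   (sym (m∸n≡1+m∸1+n i<m))
                                   (Graph.sym G _ _ (node-adj w (m∸1+i<m i<m)))
    ; node-inj = λ {i} {j} i≤m j≤m eq →
                   ∸-cancelˡ-≡ i≤m j≤m (node-inj w (m∸n≤m m i) (m∸n≤m m j) eq)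
    }
    where
    m∸1+i<m : ∀ {i} → i < m → m ∸ suc i < m
    m∸1+i<m i<m = ∸-monoʳ-< (s≤s z≤n) i<m

  module _ (κ : Fin n → Fin n → ℕ) where

    stepColour : ∀ {u v m} → Walk u v m → ℕ → ℕ
    stepColour w i = κ (node w i) (node w (suc i))

    DistinctColours : ∀ {u v m} → Walk u v m → Set
    DistinctColours {m = m} w =
      ∀ {i j} → i < m → j < m → stepColour w i ≡ stepColour w j → i ≡ j

    stay-distinct : ∀ u → DistinctColours (stay u)
    stay-distinct _ ()

    edgeWalk-distinct : ∀ {u v} (u~v : Adj G u v) → DistinctColours (edgeWalk u~v)
    edgeWalk-distinct _ {zero} {zero} _ _ _ = refl
    edgeWalk-distinct _ {suc _} (s≤s ()) _
    edgeWalk-distinct _ {_} {suc _} _ (s≤s ())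

    reverse-distinct : (∀ u w → κ u w ≡ κ w u) → ∀ {u v m} (w : Walk u v m) →
                       DistinctColours w → DistinctColours (reverse w)
    reverse-distinct κ-sym {m = m} w distinct {i} {j} i<m j<m eq =
      suc-injective (∸-cancelˡ-≡ i<m j<m
        (distinct (∸-monoʳ-< (s≤s z≤n) i<m) (∸-monoʳ-< (s≤s z≤n) j<m)
          (trans (sym (reversed-step i<m)) (trans eq (reversed-step j<m)))))
      where
      reversed-step : ∀ {k} → k < m → stepColour (reverse w) k ≡ stepColour w (m ∸ suc k)
      reversed-step {k} k<m =
        trans (κ-sym _ _) (cong (λ l → κ (node w (m ∸ suc k)) (node w l)) (m∸n≡1+m∸1+n k<m))

    module _ {k : ℕ} (κ<k : ∀ u w → κ u w < k) (κ-sym : ∀ u w → κ u w ≡ κ w u) where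

      boundedColouring : EdgeColouring G k
      boundedColouring = record
        { col     = λ u w → fromℕ< (κ<k u w)
        ; col-sym = λ u w _ → toℕ-injective (begin
            toℕ (fromℕ< (κ<k u w)) ≡⟨ toℕ-fromℕ< (κ<k u w) ⟩
            κ u w                  ≡⟨ κ-sym u w ⟩
            κ w u                  ≡⟨ toℕ-fromℕ< (κ<k w u) ⟨
            toℕ (fromℕ< (κ<k w u)) ∎)
        }
        where open ≡-Reasoning

      Walk⇒Path-rainbow : ∀ {u v m} (w : Walk u v m) → DistinctColours w →
                          Rainbow boundedColouring (Walk⇒Path w)
      Walk⇒Path-rainbow w distinct i j eq = toℕ-injective
        (distinct (toℕ<n i) (toℕ<n j)
          (subst₂ (λ i′ j′ → κ (node w i′) (node w (suc (toℕ i)))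
                           ≡ κ (node w j′) (node w (suc (toℕ j))))
                  (toℕ-inject₁ i) (toℕ-inject₁ j)
                  (trans (sym (toℕ-fromℕ< _)) (trans (cong toℕ eq) (toℕ-fromℕ< _)))))

  adjacent⇒dist1 : ∀ {u v} → Adj G u v → IsDist G u v 1
  adjacent⇒dist1 {u} u~v = Walk⇒Path (edgeWalk u~v) , shortest
    where
    shortest : ∀ m → Path G u _ m → 1 ≤ m
    shortest zero    p = contradiction (subst (Adj G u) (sym (trans (sym (start p)) (end p))) u~v)
                                       (irrefl G u)
    shortest (suc _) _ = s≤s z≤n

rainbow⇒length≤colours : ∀ {n} {G : Graph n} {k} (c : EdgeColouring G k) {u v m}
                         (p : Path G u v m) → Rainbow c p → m ≤ k
rainbow⇒length≤colours c p rainbow = injective⇒≤ (λ {i} {j} → rainbow i j)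

diam≤colours : ∀ {n} {G : Graph n} {d k} → IsDiam G d →
               Σ (EdgeColouring G k) RainbowConnected → d ≤ k
diam≤colours ((u , v , _ , shortest) , _) (c , connected) with connected u v
... | m , p , rainbow = ≤-trans (shortest m p) (rainbow⇒length≤colours c p rainbow)

adjacent⇒1≤diam : ∀ {n} {G : Graph n} {u v d} → Adj G u v → IsDiam G d → 1 ≤ d
adjacent⇒1≤diam {G = G} {u} {v} u~v (_ , largest) = largest u v 1 (Walks.adjacent⇒dist1 G u~v)

p≤p+1 : ∀ p → p ≤ℚ p +ℚ 1ℚ
p≤p+1 p = subst (_≤ℚ p +ℚ 1ℚ) (ℚ.+-identityʳ p) (ℚ.+-monoʳ-≤ p (ℚ.nonNegative⁻¹ 1ℚ))

module UnitIntervalLayering {n : ℕ} (G : Graph n) (uig : IsUnitIntervalGraph G)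
                            (connected : Connected G) (s₀ : Fin n) where

  open Walks G
  open Data.List.Extrema (DecTotalOrder.totalOrder ℚ.≤-decTotalOrder)

  x : Fin n → ℚ
  x = proj₁ uig

  Near : Fin n → Fin n → Set
  Near u v = (x u ≤ℚ x v +ℚ 1ℚ) × (x v ≤ℚ x u +ℚ 1ℚ)

  near? : ∀ u → Decidable (Near u)
  near? u v = (x u ℚ.≤? x v +ℚ 1ℚ) ×-dec (x v ℚ.≤? x u +ℚ 1ℚ)

  near-refl : ∀ u → Near u u
  near-refl u = p≤p+1 (x u) , p≤p+1 (x u)

  adj⇒near : ∀ {u v} → Adj G u v → Near u v
  adj⇒near {u} {v} u~v = proj₂ (proj₁ (proj₂ uig u v) u~v)

  near⇒adj : ∀ {u v} → u ≢ v → Near u v → Adj G u v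
  near⇒adj {u} {v} u≢v near = proj₂ (proj₂ uig u v) (u≢v , near)

  leftmost : Fin n
  leftmost = argmin x s₀ (allFin n)

  leftmost-≤ : ∀ u → x leftmost ≤ℚ x u
  leftmost-≤ u = lookup (f[argmin]≤f[xs] s₀ (allFin n)) (∈-allFin u)

  rightmost : Fin n
  rightmost = argmax x s₀ (allFin n)

  rightmost-≥ : ∀ u → x u ≤ℚ x rightmost
  rightmost-≥ u = lookup (f[xs]≤f[argmax] s₀ (allFin n)) (∈-allFin u)

  furthest : Fin n → Fin n
  furthest u = argmax x u (filter (near? u) (allFin n))

  furthest-near : ∀ u → Near u (furthest u)
  furthest-near u = argmax-all x (near-refl u) (all-filter (near? u) (allFin n))

  furthest-≥ : ∀ {u v} → Near u v → x v ≤ℚ x (furthest u)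
  furthest-≥ {u} {v} near =
    lookup (f[xs]≤f[argmax] u _) (∈-filter⁺ (near? u) (∈-allFin v) near)

  greedy : ℕ → Fin n
  greedy zero    = leftmost
  greedy (suc k) = furthest (greedy k)

  greedy-≤-suc : ∀ k → x (greedy k) ≤ℚ x (greedy (suc k))
  greedy-≤-suc k = furthest-≥ (near-refl (greedy k))

  greedy-suc-≤+1 : ∀ k → x (greedy (suc k)) ≤ℚ x (greedy k) +ℚ 1ℚ
  greedy-suc-≤+1 k = proj₂ (furthest-near (greedy k))

  greedy-mono : ∀ {i j} → i ≤ j → x (greedy i) ≤ℚ x (greedy j)
  greedy-mono {i} {j} i≤j = subst (λ k → x (greedy i) ≤ℚ x (greedy k)) (m∸n+n≡m i≤j) (climb (j ∸ i))
    where
    climb : ∀ d → x (greedy i) ≤ℚ x (greedy (d + i))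
    climb zero    = ℚ.≤-refl
    climb (suc d) = ℚ.≤-trans (climb d) (greedy-≤-suc (d + i))

  -- A neighbour of a vertex left of greedy k is either left of greedy k or near it.
  greedy-reach : ∀ k {u w} → x u ≤ℚ x (greedy k) → Adj G u w → x w ≤ℚ x (greedy (suc k))
  greedy-reach k {u} {w} u≤gk u~w with x w ℚ.≤? x (greedy k)
  ... | yes w≤gk = ℚ.≤-trans w≤gk (greedy-≤-suc k)
  ... | no  w≰gk = furthest-≥
    ( ℚ.≤-trans (ℚ.<⇒≤ (ℚ.≰⇒> w≰gk)) (p≤p+1 (x w))
    , ℚ.≤-trans (proj₂ (adj⇒near u~w)) (ℚ.+-monoˡ-≤ 1ℚ u≤gk) )

  path-end≤greedy : ∀ {u m} → Path G leftmost u m → x u ≤ℚ x (greedy m)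
  path-end≤greedy {u} {m} p =
    subst (λ v → x v ≤ℚ x (greedy m)) (end p) (vtx≤greedy m (fromℕ m) (toℕ-fromℕ m))
    where
    vtx≤greedy : ∀ k i → toℕ i ≡ k → x (vtx p i) ≤ℚ x (greedy k)
    vtx≤greedy zero    fzero    _      = ℚ.≤-reflexive (cong x (start p))
    vtx≤greedy (suc k) (fsuc i)   1+i≡k =
      greedy-reach k (vtx≤greedy k (inject₁ i) (trans (toℕ-inject₁ i) (suc-injective 1+i≡k)))
                   (adjacent p i)

  furthest-cong : ∀ {u v} → x u ≡ x v → x (furthest u) ≤ℚ x (furthest v)
  furthest-cong {u} {v} xu≡xv =
    furthest-≥ (subst (λ q → (q ≤ℚ x (furthest u) +ℚ 1ℚ) × (x (furthest u) ≤ℚ q +ℚ 1ℚ))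
                      xu≡xv (furthest-near u))

  greedy-stalls : ∀ {k} → x (greedy (suc k)) ≡ x (greedy k) →
                  ∀ d → x (greedy (d + k)) ≡ x (greedy k)
  greedy-stalls     stall zero    = refl
  greedy-stalls {k} stall (suc d) =
    trans (ℚ.≤-antisym (furthest-cong ih) (furthest-cong (sym ih))) stall
    where
    ih : x (greedy (d + k)) ≡ x (greedy k)
    ih = greedy-stalls stall d

  Reached : Fin n → ℕ → Set
  Reached u k = x u ≤ℚ x (greedy k)

  layer-exists : ∀ u → ∃ (Least (Reached u))
  layer-exists u with connected leftmost u
  ... | m , p = least-exists (λ k → x u ℚ.≤? x (greedy k)) m (path-end≤greedy p)

  -- Opaque so that conversion checking never unfolds the search over ℚ comparisons.
  opaque
    layer : Fin n → ℕ
    layer u = proj₁ (layer-exists u)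

    layer-least : ∀ u → Least (Reached u) (layer u)
    layer-least u = proj₂ (layer-exists u)

  layer-≤ : ∀ {u k} → Reached u k → layer u ≤ k
  layer-≤ {u} = Least⇒≤ (layer-least u)

  greedy-strict : ∀ {u k} → k < layer u → x (greedy k) <ℚ x (greedy (suc k))
  greedy-strict {u} {k} k<ℓ with x (greedy (suc k)) ℚ.≤? x (greedy k)
  ... | no  gk+1≰gk = ℚ.≰⇒> gk+1≰gk
  ... | yes gk+1≤gk = contradiction (subst (x u ≤ℚ_) stalled (proj₁ (layer-least u)))
                                    (proj₂ (layer-least u) k<ℓ)
    where
    stalled : x (greedy (layer u)) ≡ x (greedy k)
    stalled = subst (λ j → x (greedy j) ≡ x (greedy k)) (m∸n+n≡m (<⇒≤ k<ℓ))
                    (greedy-stalls (ℚ.≤-antisym gk+1≤gk (greedy-≤-suc k)) (layer u ∸ k))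

  greedy-strictMono : ∀ {u i j} → i < j → j ≤ layer u → x (greedy i) <ℚ x (greedy j)
  greedy-strictMono {j = suc j} i<1+j 1+j≤ℓ =
    ℚ.≤-<-trans (greedy-mono (≤-pred i<1+j)) (greedy-strict 1+j≤ℓ)

  layer-greedy : ∀ {u k} → k ≤ layer u → layer (greedy k) ≡ k
  layer-greedy {k = k} k≤ℓ = Least-unique (layer-least (greedy k)) (ℚ.≤-refl , unreached)
    where
    unreached : ∀ {j} → j < k → ¬ Reached (greedy k) j
    unreached j<k gk≤gj = ℚ.<-irrefl refl (ℚ.<-≤-trans (greedy-strictMono j<k k≤ℓ) gk≤gj)

  depth : ℕ
  depth = layer rightmost

  layer≤depth : ∀ u → layer u ≤ depth
  layer≤depth u = layer-≤ (ℚ.≤-trans (rightmost-≥ u) (proj₁ (layer-least rightmost)))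

  InBand : ℕ → Fin n → Set
  InBand k u = (x (greedy k) ≤ℚ x u) × (x u ≤ℚ x (greedy (suc k)))

  band-clique : ∀ k {u w} → InBand k u → InBand k w → u ≢ w → Adj G u w
  band-clique k (gk≤u , u≤gk+1) (gk≤w , w≤gk+1) u≢w =
    near⇒adj u≢w (≤+1 u≤gk+1 gk≤w , ≤+1 w≤gk+1 gk≤u)
    where
    ≤+1 : ∀ {p q} → p ≤ℚ x (greedy (suc k)) → x (greedy k) ≤ℚ q → p ≤ℚ q +ℚ 1ℚ
    ≤+1 p≤ gk≤q = ℚ.≤-trans p≤ (ℚ.≤-trans (greedy-suc-≤+1 k) (ℚ.+-monoˡ-≤ 1ℚ gk≤q))

  greedy∈band : ∀ k → InBand k (greedy k)
  greedy∈band k = ℚ.≤-refl , greedy-≤-suc k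

  ∈band : ∀ u → InBand (pred (layer u)) u
  ∈band u with layer u | layer-least u
  ... | zero  | u≤g0 , _      = leftmost-≤ u , ℚ.≤-trans u≤g0 (greedy-≤-suc 0)
  ... | suc k | u≤gk+1 , below = ℚ.<⇒≤ (ℚ.≰⇒> (below ≤-refl)) , u≤gk+1

  layerColour : Fin n → Fin n → ℕ
  layerColour u w = pred (layer u ⊔ layer w)

  layerColour-sym : ∀ u w → layerColour u w ≡ layerColour w u
  layerColour-sym u w = cong pred (⊔-comm (layer u) (layer w))

  RainbowWalk : Fin n → Fin n → ℕ → Set
  RainbowWalk u v m = Σ (Walk u v m) (DistinctColours layerColour)

  -- The walk u, greedy (1 + r), greedy (2 + r), …, v: from u every step climbs exactly one layer.
  module Climb {r : ℕ} {u v : Fin n} (u∈band : InBand r u) (layer-u≤ : layer u ≤ suc r)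
               (u≢greedy : layer u ≡ suc r → u ≢ greedy (suc r))
               (layer-u< : layer u < layer v) (r<layer-v : r < layer v) where

    Q : ℕ
    Q = layer v ∸ suc r

    Q+1+r≡layer-v : Q + suc r ≡ layer v
    Q+1+r≡layer-v = m∸n+n≡m r<layer-v

    stair : ℕ → Fin n
    stair i with i <? Q
    ... | yes _ = greedy (i + suc r)
    ... | no  _ = v

    stair-greedy : ∀ {i} → i < Q → stair i ≡ greedy (i + suc r)
    stair-greedy {i} i<Q with i <? Q
    ... | yes _   = refl
    ... | no  i≮Q = contradiction i<Q i≮Q

    stair-end : stair Q ≡ v
    stair-end with Q <? Q
    ... | yes Q<Q = contradiction Q<Q (<-irrefl refl)
    ... | no  _   = refl

    layer-stair : ∀ {i} → i ≤ Q → layer (stair i) ≡ i + suc r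
    layer-stair {i} i≤Q with m≤n⇒m<n∨m≡n i≤Q
    ... | inj₁ i<Q  = trans (cong layer (stair-greedy i<Q))
                            (layer-greedy (≤-trans (+-monoˡ-≤ (suc r) (<⇒≤ i<Q))
                                                   (≤-reflexive Q+1+r≡layer-v)))
    ... | inj₂ refl = trans (cong layer stair-end) (sym Q+1+r≡layer-v)

    stair∈band : ∀ {i} → i ≤ Q → InBand (pred (i + suc r)) (stair i)
    stair∈band {i} i≤Q = subst (λ ℓ → InBand (pred ℓ) (stair i)) (layer-stair i≤Q) (∈band (stair i))

    u≢stair : ∀ {j} → j ≤ Q → u ≢ stair j
    u≢stair {zero}  _   u≡s0 = u≢greedy layer-u≡ (trans u≡s0 (stair-greedy 0<Q))
      where
      layer-u≡ : layer u ≡ suc r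
      layer-u≡ = trans (cong layer u≡s0) (layer-stair z≤n)
      0<Q : 0 < Q
      0<Q = m<n⇒0<n∸m (subst (_< layer v) layer-u≡ layer-u<)
    u≢stair {suc j} j≤Q u≡sj = <⇒≱ (m<n+m (suc r) (s≤s z≤n))
      (subst (_≤ suc r) (trans (cong layer u≡sj) (layer-stair j≤Q)) layer-u≤)

    vertex : ℕ → Fin n
    vertex zero    = u
    vertex (suc i) = stair i

    vertex-inj : ∀ {i j} → i ≤ suc Q → j ≤ suc Q → vertex i ≡ vertex j → i ≡ j
    vertex-inj {zero}  {zero}  _         _         _  = refl
    vertex-inj {zero}  {suc j} _         (s≤s j≤Q) eq = contradiction eq (u≢stair j≤Q)
    vertex-inj {suc i} {zero}  (s≤s i≤Q) _         eq = contradiction (sym eq) (u≢stair i≤Q)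
    vertex-inj {suc i} {suc j} (s≤s i≤Q) (s≤s j≤Q) eq = cong suc (+-cancelʳ-≡ (suc r) i j
      (trans (sym (layer-stair i≤Q)) (trans (cong layer eq) (layer-stair j≤Q))))

    vertex≢next : ∀ {i} → i < suc Q → vertex i ≢ vertex (suc i)
    vertex≢next i<1+Q eq = 1+n≢n (sym (vertex-inj (<⇒≤ i<1+Q) i<1+Q eq))

    vertex-adj : ∀ {i} → i < suc Q → Adj G (vertex i) (vertex (suc i))
    vertex-adj {zero}  i<1+Q     = band-clique r u∈band (stair∈band z≤n) (vertex≢next i<1+Q)
    vertex-adj {suc i} (s≤s i<Q) = band-clique (i + suc r)
      (subst (InBand (i + suc r)) (sym (stair-greedy i<Q)) (greedy∈band (i + suc r)))
      (stair∈band i<Q) (vertex≢next (s≤s i<Q))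

    walk : Walk u v (suc Q)
    walk = record
      { node = vertex ; node-0 = refl ; node-m = stair-end
      ; node-adj = vertex-adj ; node-inj = vertex-inj }

    stepColour≡ : ∀ {i} → i < suc Q → stepColour layerColour walk i ≡ i + r
    stepColour≡ {zero}  _         = cong pred (trans (cong (layer u ⊔_) (layer-stair z≤n))
                                                     (m≤n⇒m⊔n≡n layer-u≤))
    stepColour≡ {suc i} (s≤s i<Q) = begin
      pred (layer (stair i) ⊔ layer (stair (suc i)))
        ≡⟨ cong₂ (λ a b → pred (a ⊔ b)) (layer-stair (<⇒≤ i<Q)) (layer-stair i<Q) ⟩
      pred ((i + suc r) ⊔ suc (i + suc r))
        ≡⟨ cong pred (m≤n⇒m⊔n≡n (n≤1+n _)) ⟩
      i + suc r
        ≡⟨ +-suc i r ⟩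
      suc i + r ∎
      where open ≡-Reasoning

    rainbowWalk : RainbowWalk u v (suc Q)
    rainbowWalk = walk , λ {i} {j} i<1+Q j<1+Q eq →
      +-cancelʳ-≡ r i j (trans (sym (stepColour≡ i<1+Q)) (trans eq (stepColour≡ j<1+Q)))

  InBand? : ∀ k → Decidable (InBand k)
  InBand? k u = (x (greedy k) ℚ.≤? x u) ×-dec (x u ℚ.≤? x (greedy (suc k)))

  outside-own-band : ∀ {u} → ¬ InBand (layer u) u → layer u ≡ suc (pred (layer u))
  outside-own-band {u} u∉ with layer u | ∈band u
  ... | zero  | u∈ = contradiction u∈ u∉
  ... | suc _ | _  = refl

  climbing-walk : ∀ {u v} → layer u < layer v → ∃ (RainbowWalk u v)
  -- Outside its own band, u is in the band below and is not the greedy vertex of its layer.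
  climbing-walk {u} {v} ℓu<ℓv with InBand? (layer u) u
  ... | yes u∈ = _ , Climb.rainbowWalk u∈ (n≤1+n _) (λ ℓ≡1+ℓ → contradiction (sym ℓ≡1+ℓ) 1+n≢n)
                                        ℓu<ℓv ℓu<ℓv
  ... | no  u∉ = _ , Climb.rainbowWalk (∈band u) (≤-reflexive ℓu≡) u≢greedy
                                        ℓu<ℓv (≤-<-trans pred[n]≤n ℓu<ℓv)
    where
    ℓu≡ : layer u ≡ suc (pred (layer u))
    ℓu≡ = outside-own-band u∉
    u≢greedy : layer u ≡ suc (pred (layer u)) → u ≢ greedy (suc (pred (layer u)))
    u≢greedy _ u≡g = u∉ (subst (InBand (layer u)) (sym u≡g)
                               (subst (λ k → InBand k (greedy (suc (pred (layer u))))) (sym ℓu≡)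
                                      (greedy∈band (suc (pred (layer u))))))

  same-layer-walk : ∀ {u v} → layer u ≡ layer v → u ≢ v → RainbowWalk u v 1
  same-layer-walk {u} {v} ℓu≡ℓv u≢v = edgeWalk u~v , edgeWalk-distinct layerColour u~v
    where
    u~v : Adj G u v
    u~v = band-clique (pred (layer u)) (∈band u)
                      (subst (λ ℓ → InBand (pred ℓ) v) (sym ℓu≡ℓv) (∈band v)) u≢v

  rainbowWalk : ∀ u v → ∃ (RainbowWalk u v)
  rainbowWalk u v with <-cmp (layer u) (layer v)
  ... | tri< ℓu<ℓv _ _ = climbing-walk ℓu<ℓv
  ... | tri> _ _ ℓv<ℓu with climbing-walk ℓv<ℓu
  ...   | m , w , distinct = m , reverse w , reverse-distinct layerColour layerColour-sym w distinct
  rainbowWalk u v | tri≈ _ ℓu≡ℓv _ with u ≟ v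
  ... | yes refl = 0 , stay u , stay-distinct layerColour u
  ... | no  u≢v  = 1 , same-layer-walk ℓu≡ℓv u≢v

  layerColour< : ∀ {k} → 1 ≤ k → depth ≤ k → ∀ u w → layerColour u w < k
  layerColour< 1≤k depth≤k u w with layer u ⊔ layer w | ⊔-lub (layer≤depth u) (layer≤depth w)
  ... | zero  | _        = 1≤k
  ... | suc _ | ℓ≤depth  = ≤-trans ℓ≤depth depth≤k

  rainbowConnection : ∀ {k} → 1 ≤ k → depth ≤ k → Σ (EdgeColouring G k) RainbowConnected
  rainbowConnection {k} 1≤k depth≤k = colouring , connected′
    where
    κ<k : ∀ u w → layerColour u w < k
    κ<k = layerColour< 1≤k depth≤k
    colouring : EdgeColouring G k
    colouring = boundedColouring layerColour κ<k layerColour-sym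
    connected′ : RainbowConnected colouring
    connected′ u v with rainbowWalk u v
    ... | m , w , distinct =
      m , Walk⇒Path w , Walk⇒Path-rainbow layerColour κ<k layerColour-sym w distinct

  leftmost-rightmost-dist : 0 < depth → IsDist G leftmost rightmost depth
  leftmost-rightmost-dist 0<depth =
    subst (Path G leftmost rightmost) (trans (+-comm 1 Q) Q+1+r≡layer-v) (Walk⇒Path walk) ,
    λ _ p → layer-≤ (path-end≤greedy p)
    where
    layer-leftmost : layer leftmost ≡ 0
    layer-leftmost = n≤0⇒n≡0 (layer-≤ ℚ.≤-refl)
    open Climb {r = 0} (greedy∈band 0) (≤-trans (≤-reflexive layer-leftmost) z≤n)
               (λ ℓ≡1 → contradiction (trans (sym layer-leftmost) ℓ≡1) λ ())
               (subst (_< depth) (sym layer-leftmost) 0<depth) 0<depth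

  depth≤diam : ∀ {d} → IsDiam G d → depth ≤ d
  depth≤diam (_ , largest) with 0 <? depth
  ... | yes 0<depth = largest leftmost rightmost depth (leftmost-rightmost-dist 0<depth)
  ... | no  0≮depth = ≤-trans (≮⇒≥ 0≮depth) z≤n

theorem4 : ∀ (n : ℕ) (G : Graph n) → IsUnitIntervalGraph G → Connected G
    → MinDegreeAtLeast2 G → ∀ (d : ℕ) → IsDiam G d → IsRc G d
theorem4 _ G uig connected minDegree _ diam@((s₀ , _) , _) with minDegree s₀
... | _ , _ , _ , s₀~a , _ =
  rainbowConnection (adjacent⇒1≤diam s₀~a diam) (depth≤diam diam) ,
  λ j j<d rainbow → <⇒≱ j<d (diam≤colours diam rainbow)
  where open UnitIntervalLayering G uig connected s₀
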